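{- There exists a graph that is weakly transitive and weakly isomorphic to a (vertex-)transitive graph, but that is not (vertex-)transitive.
   Context: A graph is a pair $(V,E)$ with $E$ a set of 2-element subsets of $V$, connected and non-empty, not necessarily locally finite. A graph is (vertex-)transitive if its automorphism group acts transitively on its vertices. For a vertex $u$ and $r\geq0$, the ball $B(u,r)$ is the set of vertices at graph distance at most $r$ from $u$, viewed as the induced subgraph rooted at $u$; rooted graph isomorphisms are graph isomorphisms sending root to root. A graph is weakly transitive if for all vertices $o,o'$ and every positive integer $n$, the rooted graphs $B(o,n)$ and $B(o',n)$ are isomorphic. Two weakly transitive graphs are weakly isomorphic if for every positive integer $k$, their balls of radius $k$ are isomorphic as rooted graphs. -}

module Defs where

open import Data.Nat using (ℕ; zero; suc; _≤_)
open import Data.Product using (Σ; ∃; ∃-syntax; _×_; _,_; proj₁; proj₂)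
open import Relation.Nullary using (¬_)
open import Relation.Binary.PropositionalEquality using (_≡_)
open import Function.Bundles using (_⇔_; _↔_; Inverse)

data Walk {V : Set} (E : V → V → Set) : V → V → ℕ → Set where
  here : ∀ {u} → Walk E u u zero
  step : ∀ {u w v n} → E u w → Walk E w v n → Walk E u v (suc n)

-- A (simple, undirected, connected, non-empty) graph; not necessarily locally
-- finite. E u v means {u,v} is an edge.
record Graph : Set₁ where
  field
    V         : Set
    E         : V → V → Set
    E-sym     : ∀ {u v} → E u v → E v u
    E-irrefl  : ∀ {v} → ¬ E v v
    nonempty  : V
    connected : ∀ u v → ∃[ n ] Walk E u v n

open Graph public

InBall : (G : Graph) → V G → ℕ → V G → Set
InBall G u r v = ∃[ n ] (n ≤ r × Walk (E G) u v n)

-- vertex set of the ball B(u,r); elements are compared by their first component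
Ball : (G : Graph) → V G → ℕ → Set
Ball G u r = Σ (V G) (InBall G u r)

root : (G : Graph) (u : V G) (r : ℕ) → Ball G u r
root G u r = u , (zero , (Data.Nat.z≤n , here))

record BallIso (G : Graph) (o : V G) (H : Graph) (o' : V H) (r : ℕ) : Set where
  field
    to       : Ball G o r → Ball H o' r
    from     : Ball H o' r → Ball G o r
    to-cong  : ∀ x y → proj₁ x ≡ proj₁ y → proj₁ (to x) ≡ proj₁ (to y)
    from-cong : ∀ x y → proj₁ x ≡ proj₁ y → proj₁ (from x) ≡ proj₁ (from y)
    from-to  : ∀ x → proj₁ (from (to x)) ≡ proj₁ x
    to-from  : ∀ y → proj₁ (to (from y)) ≡ proj₁ y
    to-adj   : ∀ x y → E G (proj₁ x) (proj₁ y) ⇔ E H (proj₁ (to x)) (proj₁ (to y))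
    to-root  : proj₁ (to (root G o r)) ≡ o'

record Automorphism (G : Graph) : Set where
  field
    bij : V G ↔ V G
    adj : ∀ u v → E G u v ⇔ E G (Inverse.to bij u) (Inverse.to bij v)

Transitive : Graph → Set
Transitive G = ∀ u v → Σ (Automorphism G) λ φ → Inverse.to (Automorphism.bij φ) u ≡ v

WeaklyTransitive : Graph → Set
WeaklyTransitive G = ∀ (o o' : V G) (n : ℕ) → BallIso G o G o' (suc n)

WeaklyIsomorphic : Graph → Graph → Set
WeaklyIsomorphic G H = ∀ (o : V G) (o' : V H) (k : ℕ) → BallIso G o H o' (suc k)

module Submission where

-- Cay, the Cayley graph of the free product of infinitely many copies of each cyclic group
-- ℤ/(K + 3), is vertex-transitive, and each of its edges lies on a cycle. Comb hangs a copy of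
-- Cay at every integer and joins the copies of the identity along a line. The line edges are
-- bridges, while a vertex off the line has all its edges inside a copy of Cay; so Comb is not
-- transitive. Yet every ball of radius R in Comb is isomorphic to a ball of Cay: wrap the line
-- onto the cycle of a factor of order 2R + 3, after relabelling the letters of the word that
-- already use that factor. Hence Comb is weakly isomorphic to Cay, and thereby weakly transitive.

open import Defs
open import Data.Nat using (ℕ; zero; suc; _+_; _≤_; _<_; s≤s)
open import Data.Nat.Properties
  using (_≟_; suc-injective; 1+n≢0; 1+n≢n; ≤-refl; ≤-reflexive; ≤-trans; n≤1+n; m≤m+n; +-suc; +-comm;
         +-mono-≤; +-cancelˡ-≡; <-irrefl; <-pred; ≤-pred)
open import Data.Integer using (ℤ; +_; -[1+_]; ∣_∣; 1ℤ; -1ℤ)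
  renaming (suc to sucℤ; pred to predℤ; _+_ to _+ℤ_; -_ to -ℤ_)
import Data.Integer.Properties as ℤ
open import Algebra.Properties.CommutativeSemigroup ℤ.+-commutativeSemigroup using (x∙yz≈y∙xz)
open import Data.Fin using (Fin; zero; suc; fromℕ; toℕ)
open import Data.Fin.Properties using (toℕ-fromℕ; toℕ-injective; toℕ<n) renaming (suc-injective to Fin-suc-injective)
open import Data.Maybe using (Maybe; just; nothing)
import Data.Maybe as Maybe
open import Data.Maybe.Properties using (just-injective)
open import Data.List using (List; []; _∷_; map)
open import Data.List.Properties using (∷-injectiveˡ; ∷-injectiveʳ)
open import Data.Bool using (Bool; true; not; T)
open import Data.Bool.Properties using (T-irrelevant)
open import Data.Unit using (⊤; tt)
open import Data.Empty using (⊥; ⊥-elim)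
open import Data.Product using (Σ; ∃-syntax; _×_; _,_; proj₁; proj₂)
import Data.Product.Properties as Product
open import Relation.Nullary using (¬_; Dec; yes; no; does; contradiction)
open import Relation.Binary.PropositionalEquality
open ≡-Reasoning
open import Function.Base using (_∘_)
open import Function.Bundles using (Inverse; Equivalence; mk⇔; mk↔ₛ′)

iterate : {A : Set} → (A → A) → ℕ → A → A
iterate f zero x = x
iterate f (suc k) x = f (iterate f k x)

module _ {V : Set} {E : V → V → Set} where

  appendWalk : ∀ {u v w m n} → Walk E u v m → Walk E v w n → Walk E u w (m + n)
  appendWalk here q = q
  appendWalk (step e p) q = step e (appendWalk p q)

  snocWalk : ∀ {u v w n} → Walk E u v n → E v w → Walk E u w (suc n)
  snocWalk here e = step e here
  snocWalk (step e p) e′ = step e (snocWalk p e′)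

  reverseWalk : (∀ {x y} → E x y → E y x) → ∀ {u v n} → Walk E u v n → Walk E v u n
  reverseWalk sym-E here = here
  reverseWalk sym-E (step e p) = snocWalk (reverseWalk sym-E p) (sym-E e)

mapWalk : {V W : Set} {E : V → V → Set} {F : W → W → Set} (f : V → W) →
  (∀ {x y} → E x y → F (f x) (f y)) → ∀ {u v n} → Walk E u v n → Walk F (f u) (f v) n
mapWalk f f-E here = here
mapWalk f f-E (step e w) = step (f-E e) (mapWalk f f-E w)

open Equivalence using () renaming (to to ⇒; from to ⇐)

BallIso-trans : ∀ {G H K : Graph} {o o′ o″ r} →
  BallIso G o H o′ r → BallIso H o′ K o″ r → BallIso G o K o″ r
BallIso-trans {G} {H} {o = o} {o′} {r = r} f g = record
  { to = λ x → g.to (f.to x)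
  ; from = λ y → f.from (g.from y)
  ; to-cong = λ x y eq → g.to-cong (f.to x) (f.to y) (f.to-cong x y eq)
  ; from-cong = λ x y eq → f.from-cong (g.from x) (g.from y) (g.from-cong x y eq)
  ; from-to = λ x → trans (f.from-cong (g.from (g.to (f.to x))) (f.to x) (g.from-to (f.to x))) (f.from-to x)
  ; to-from = λ y → trans (g.to-cong (f.to (f.from (g.from y))) (g.from y) (f.to-from (g.from y))) (g.to-from y)
  ; to-adj = λ x y → mk⇔ (λ e → ⇒ (g.to-adj (f.to x) (f.to y)) (⇒ (f.to-adj x y) e))
                          (λ e → ⇐ (f.to-adj x y) (⇐ (g.to-adj (f.to x) (f.to y)) e))
  ; to-root = trans (g.to-cong (f.to (root G o r)) (root H o′ r) f.to-root) g.to-root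
  }
  where
    module f = BallIso f
    module g = BallIso g

BallIso-sym : ∀ {G H : Graph} {o o′ r} → BallIso G o H o′ r → BallIso H o′ G o r
BallIso-sym {G} {H} {o} {o′} {r} f = record
  { to = f.from
  ; from = f.to
  ; to-cong = f.from-cong
  ; from-cong = f.to-cong
  ; from-to = f.to-from
  ; to-from = f.from-to
  ; to-adj = λ x y → mk⇔
      (λ e → ⇐ (f.to-adj (f.from x) (f.from y)) (subst₂ (E H) (sym (f.to-from x)) (sym (f.to-from y)) e))
      (λ e → subst₂ (E H) (f.to-from x) (f.to-from y) (⇒ (f.to-adj (f.from x) (f.from y)) e))
  ; to-root = trans (sym (f.from-cong (f.to (root G o r)) (root H o′ r) f.to-root)) (f.from-to (root G o r))
  }
  where module f = BallIso f

module _ {G : Graph} where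

  apply : Automorphism G → V G → V G
  apply φ = Inverse.to (Automorphism.bij φ)

  apply-E : (φ : Automorphism G) → ∀ {u v} → E G u v → E G (apply φ u) (apply φ v)
  apply-E φ {u} {v} = ⇒ (Automorphism.adj φ u v)

  idᴬ : Automorphism G
  idᴬ = record
    { bij = mk↔ₛ′ (λ x → x) (λ x → x) (λ _ → refl) (λ _ → refl)
    ; adj = λ u v → mk⇔ (λ e → e) (λ e → e)
    }

  _∘ᴬ_ : Automorphism G → Automorphism G → Automorphism G
  φ ∘ᴬ χ = record
    { bij = mk↔ₛ′ (λ x → φ.to (χ.to x)) (λ y → χ.from (φ.from y))
        (λ y → trans (cong φ.to (χ.strictlyInverseˡ (φ.from y))) (φ.strictlyInverseˡ y))
        (λ x → trans (cong χ.from (φ.strictlyInverseʳ (χ.to x))) (χ.strictlyInverseʳ x))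
    ; adj = λ u v → mk⇔ (λ e → apply-E φ (apply-E χ e))
                        (λ e → ⇐ (Automorphism.adj χ u v) (⇐ (Automorphism.adj φ _ _) e))
    }
    where
      module φ = Inverse (Automorphism.bij φ)
      module χ = Inverse (Automorphism.bij χ)

  _⁻¹ᴬ : Automorphism G → Automorphism G
  φ ⁻¹ᴬ = record
    { bij = mk↔ₛ′ φ.from φ.to φ.strictlyInverseʳ φ.strictlyInverseˡ
    ; adj = λ u v → mk⇔
        (λ e → ⇐ (Automorphism.adj φ (φ.from u) (φ.from v))
                  (subst₂ (E G) (sym (φ.strictlyInverseˡ u)) (sym (φ.strictlyInverseˡ v)) e))
        (λ e → subst₂ (E G) (φ.strictlyInverseˡ u) (φ.strictlyInverseˡ v) (apply-E φ e))
    }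
    where module φ = Inverse (Automorphism.bij φ)

  apply-⁻¹ᴬ : (φ : Automorphism G) → ∀ u → apply (φ ⁻¹ᴬ) (apply φ u) ≡ u
  apply-⁻¹ᴬ φ = Inverse.strictlyInverseʳ (Automorphism.bij φ)

  apply-⁻¹ᴬ′ : (φ : Automorphism G) → ∀ v → apply φ (apply (φ ⁻¹ᴬ) v) ≡ v
  apply-⁻¹ᴬ′ φ = Inverse.strictlyInverseˡ (Automorphism.bij φ)

  _^ᴬ_ : Automorphism G → ℕ → Automorphism G
  φ ^ᴬ zero = idᴬ
  φ ^ᴬ suc n = φ ∘ᴬ (φ ^ᴬ n)

  apply-^ᴬ : (φ : Automorphism G) → ∀ n u → apply (φ ^ᴬ n) u ≡ iterate (apply φ) n u
  apply-^ᴬ φ zero u = refl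
  apply-^ᴬ φ (suc n) u = cong (apply φ) (apply-^ᴬ φ n u)

  Automorphism⇒BallIso : (φ : Automorphism G) → ∀ {o o′} r → apply φ o ≡ o′ → BallIso G o G o′ r
  Automorphism⇒BallIso φ {o} r refl = record
    { to = λ { (x , n , n≤r , w) → apply φ x , n , n≤r , mapWalk (apply φ) (apply-E φ) w }
    ; from = λ { (y , n , n≤r , w) → apply (φ ⁻¹ᴬ) y , n , n≤r ,
                   subst (λ z → Walk (E G) z _ n) (apply-⁻¹ᴬ φ o)
                     (mapWalk (apply (φ ⁻¹ᴬ)) (apply-E (φ ⁻¹ᴬ)) w) }
    ; to-cong = λ { x y refl → refl }
    ; from-cong = λ { x y refl → refl }
    ; from-to = λ x → apply-⁻¹ᴬ φ (proj₁ x)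
    ; to-from = λ y → apply-⁻¹ᴬ′ φ (proj₁ y)
    ; to-adj = λ x y → Automorphism.adj φ (proj₁ x) (proj₁ y)
    ; to-root = refl
    }

  Transitive-fromBase : (b : V G) → (∀ v → Σ (Automorphism G) λ φ → apply φ b ≡ v) → Transitive G
  Transitive-fromBase b reach u v with reach u | reach v
  ... | φ , refl | χ , refl = χ ∘ᴬ (φ ⁻¹ᴬ) , cong (apply χ) (apply-⁻¹ᴬ φ b)

  Avoiding : V G → V G → V G → Set
  Avoiding u x y = E G x y × x ≢ u × y ≢ u

  -- Equivalent to the edge ua being a bridge: a walk from a back to u avoiding
  -- that edge would first reach another neighbour b of u.
  IncidentToBridge : V G → Set
  IncidentToBridge u = Σ (V G) λ a → E G u a ×
    (∀ b → E G u b → b ≢ a → ∀ n → ¬ Walk (Avoiding u) a b n)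

  IncidentToBridge-apply : (φ : Automorphism G) → ∀ {u} → IncidentToBridge u → IncidentToBridge (apply φ u)
  IncidentToBridge-apply φ {u} (a , ua , isolated) =
    apply φ a , apply-E φ ua , λ b φu-b b≢φa n w →
      isolated (φ⁻¹ b) (subst (λ t → E G t (φ⁻¹ b)) (apply-⁻¹ᴬ φ u) (apply-E (φ ⁻¹ᴬ) φu-b))
        (pull-≢ b≢φa)
        n (subst (λ t → Walk (Avoiding u) t (φ⁻¹ b) n) (apply-⁻¹ᴬ φ a) (mapWalk φ⁻¹ pull w))
    where
      φ⁻¹ : V G → V G
      φ⁻¹ = apply (φ ⁻¹ᴬ)
      pull-≢ : ∀ {x y} → x ≢ apply φ y → φ⁻¹ x ≢ y
      pull-≢ {x} x≢ eq = x≢ (trans (sym (apply-⁻¹ᴬ′ φ x)) (cong (apply φ) eq))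
      pull : ∀ {x y} → Avoiding (apply φ u) x y → Avoiding u (φ⁻¹ x) (φ⁻¹ y)
      pull (e , x≢ , y≢) = apply-E (φ ⁻¹ᴬ) e , pull-≢ x≢ , pull-≢ y≢

  ¬Transitive-byBridge : ∀ {u v} → IncidentToBridge u → ¬ IncidentToBridge v → ¬ Transitive G
  ¬Transitive-byBridge {u} {v} bridge ¬bridge transitive with transitive u v
  ... | φ , refl = ¬bridge (IncidentToBridge-apply φ bridge)

data Dir : Set where
  up down : Dir

opposite : Dir → Dir
opposite up = down
opposite down = up

-- The cyclic group of order n + 2: nothing is 0 and just i is toℕ i + 1.
Cyc : ℕ → Set
Cyc n = Maybe (Fin (suc n))

next : ∀ {n} → Fin (suc n) → Cyc n
next {zero} zero = nothing
next {suc n} zero = just (suc zero)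
next {suc n} (suc i) = Maybe.map suc (next i)

prev : ∀ {n} → Fin (suc n) → Cyc n
prev zero = nothing
prev {suc n} (suc zero) = just zero
prev {suc n} (suc (suc i)) = Maybe.map suc (prev (suc i))

start : ∀ {n} → Dir → Fin (suc n)
start up = zero
start {n} down = fromℕ n

rotate : ∀ {n} → Dir → Cyc n → Cyc n
rotate d nothing = just (start d)
rotate up (just i) = next i
rotate down (just i) = prev i

rotate-down-next : ∀ {n} (i : Fin (suc n)) → rotate down (next i) ≡ just i
rotate-down-next {zero} zero = refl
rotate-down-next {suc n} zero = refl
rotate-down-next {suc n} (suc i) with next i | rotate-down-next i
... | nothing | eq = cong (λ j → just (suc j)) (just-injective eq)
... | just (suc j) | eq = cong (Maybe.map suc) eq

rotate-up-prev : ∀ {n} (i : Fin (suc n)) → rotate up (prev i) ≡ just i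
rotate-up-prev zero = refl
rotate-up-prev {suc n} (suc zero) = refl
rotate-up-prev {suc n} (suc (suc i)) with prev (suc i) | rotate-up-prev (suc i)
... | just j | eq = cong (Maybe.map suc) eq

next-last : ∀ n → next (fromℕ n) ≡ nothing
next-last zero = refl
next-last (suc n) = cong (Maybe.map suc) (next-last n)

rotate-opposite : ∀ {n} d (c : Cyc n) → rotate (opposite d) (rotate d c) ≡ c
rotate-opposite up nothing = refl
rotate-opposite {n} down nothing = next-last n
rotate-opposite up (just i) = rotate-down-next i
rotate-opposite down (just i) = rotate-up-prev i

rotate-comm : ∀ {n} d e (c : Cyc n) → rotate d (rotate e c) ≡ rotate e (rotate d c)
rotate-comm up up c = refl
rotate-comm down down c = refl
rotate-comm up down c = trans (rotate-opposite down c) (sym (rotate-opposite up c))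
rotate-comm down up c = trans (rotate-opposite up c) (sym (rotate-opposite down c))

next-≢ : ∀ {n} (i : Fin (suc n)) → next i ≢ just i
next-≢ {zero} zero ()
next-≢ {suc n} zero ()
next-≢ {suc n} (suc i) eq with next i | next-≢ i
... | just j | j≢i = j≢i (cong just (Fin-suc-injective (just-injective eq)))

rotate-≢ : ∀ {n} d (c : Cyc n) → rotate d c ≢ c
rotate-≢ d nothing ()
rotate-≢ up (just i) = next-≢ i
rotate-≢ down (just i) eq = next-≢ i (trans (sym (cong (rotate up) eq)) (rotate-up-prev i))

next-toℕ : ∀ {n} (i : Fin (suc n)) → suc (toℕ i) < suc n →
  ∃[ j ] next i ≡ just j × toℕ j ≡ suc (toℕ i)
next-toℕ {zero} zero (s≤s ())
next-toℕ {suc n} zero _ = suc zero , refl , refl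
next-toℕ {suc n} (suc i) (s≤s lt) with next i | next-toℕ i lt
... | just j | j′ , refl , eq = suc j′ , refl , cong suc eq

prev-toℕ : ∀ {n} (i : Fin (suc n)) → ∀ {k} → toℕ i ≡ suc k →
  ∃[ j ] prev i ≡ just j × suc (toℕ j) ≡ toℕ i
prev-toℕ {suc n} (suc zero) _ = zero , refl , refl
prev-toℕ {suc n} (suc (suc i)) _ with prev (suc i) | prev-toℕ (suc i) refl
... | just j | j′ , refl , eq = suc j′ , refl , cong suc eq

iterate-up-toℕ : ∀ {n} k → k < suc n →
  Σ (Fin (suc n)) λ i → iterate (rotate up) (suc k) nothing ≡ just i × toℕ i ≡ k
iterate-up-toℕ zero _ = zero , refl , refl
iterate-up-toℕ {n} (suc k) lt with iterate-up-toℕ {n} k (≤-trans (n≤1+n _) lt)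
... | i , eq , toℕi≡k with next-toℕ i (subst (λ m → suc m < suc n) (sym toℕi≡k) lt)
... | j , eq′ , toℕj = j , trans (cong (rotate up) eq) eq′ , trans toℕj (cong suc toℕi≡k)

iterate-down-toℕ : ∀ {n} k → k < suc n →
  Σ (Fin (suc n)) λ i → iterate (rotate down) (suc k) nothing ≡ just i × toℕ i + k ≡ n
iterate-down-toℕ {n} zero _ = fromℕ n , refl , trans (+-comm (toℕ (fromℕ n)) 0) (toℕ-fromℕ n)
iterate-down-toℕ {n} (suc k) lt with iterate-down-toℕ {n} k (≤-trans (n≤1+n _) lt)
... | i , eq , i+k≡n with toℕ i in toℕi
... | zero = contradiction i+k≡n λ k≡n → <-irrefl k≡n (<-pred lt)
... | suc m with prev-toℕ i toℕi
...   | j , eq′ , sucj≡i = j , trans (cong (rotate down) eq) eq′ ,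
                         trans (+-suc (toℕ j) k) (trans (cong (_+ k) (trans sucj≡i toℕi)) i+k≡n)

-- ⟨ K , i , z ⟩ is the power toℕ z + 1 of the generator of the i-th free factor of order K + 3.
record Letter : Set where
  constructor ⟨_,_,_⟩
  field
    K : ℕ
    i : ℕ
    z : Fin (suc (suc K))

Factor : Set
Factor = ℕ × ℕ

factor : Letter → Factor
factor ⟨ K , i , _ ⟩ = K , i

_≟ᶠ_ : (a b : Factor) → Dec (a ≡ b)
_≟ᶠ_ = Product.≡-dec _≟_ _≟_

-- Bool-valued so that proofs of Reduced are unique.
_≢ᵇ_ : Factor → Factor → Bool
a ≢ᵇ b = not (does (a ≟ᶠ b))

headAvoids : Factor → List Letter → Bool
headAvoids a [] = true
headAvoids a (y ∷ _) = factor y ≢ᵇ a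

≢ᵇ⇒≢ : ∀ {a b} → T (a ≢ᵇ b) → a ≢ b
≢ᵇ⇒≢ {a} {b} t eq with a ≟ᶠ b
... | no a≢b = a≢b eq

≢⇒≢ᵇ : ∀ {a b} → a ≢ b → T (a ≢ᵇ b)
≢⇒≢ᵇ {a} {b} a≢b with a ≟ᶠ b
... | yes eq = a≢b eq
... | no _ = tt

Reduced : List Letter → Set
Reduced [] = ⊤
Reduced (x ∷ l) = T (headAvoids (factor x) l) × Reduced l

Reduced-irrelevant : ∀ {l} (r r′ : Reduced l) → r ≡ r′
Reduced-irrelevant {[]} _ _ = refl
Reduced-irrelevant {x ∷ l} (h , r) (h′ , r′) = cong₂ _,_ (T-irrelevant h h′) (Reduced-irrelevant r r′)

-- A reduced word is an element of the free product; mulʳ K i d and mulˡ K i d multiply it on the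
-- right and on the left by the generator of the factor (K , i), or by its inverse if d = down.
consPower : (K i : ℕ) → Cyc (suc K) → List Letter → List Letter
consPower K i nothing l = l
consPower K i (just z) l = ⟨ K , i , z ⟩ ∷ l

mulʳ-last : (K i : ℕ) → Dir → (K′ i′ : ℕ) → Fin (suc (suc K′)) →
  Dec ((K′ , i′) ≡ (K , i)) → List Letter
mulʳ-last K i d .K .i z (yes refl) = consPower K i (rotate d (just z)) []
mulʳ-last K i d K′ i′ z (no _) = ⟨ K′ , i′ , z ⟩ ∷ ⟨ K , i , start d ⟩ ∷ []

mulʳ : (K i : ℕ) → Dir → List Letter → List Letter
mulʳ K i d [] = ⟨ K , i , start d ⟩ ∷ []
mulʳ K i d (⟨ K′ , i′ , z ⟩ ∷ []) = mulʳ-last K i d K′ i′ z ((K′ , i′) ≟ᶠ (K , i))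
mulʳ K i d (x ∷ y ∷ l) = x ∷ mulʳ K i d (y ∷ l)

mulˡ-first : (K i : ℕ) → Dir → (K′ i′ : ℕ) → Fin (suc (suc K′)) → List Letter →
  Dec ((K′ , i′) ≡ (K , i)) → List Letter
mulˡ-first K i d .K .i z l (yes refl) = consPower K i (rotate d (just z)) l
mulˡ-first K i d K′ i′ z l (no _) = ⟨ K , i , start d ⟩ ∷ ⟨ K′ , i′ , z ⟩ ∷ l

mulˡ : (K i : ℕ) → Dir → List Letter → List Letter
mulˡ K i d [] = ⟨ K , i , start d ⟩ ∷ []
mulˡ K i d (⟨ K′ , i′ , z ⟩ ∷ l) = mulˡ-first K i d K′ i′ z l ((K′ , i′) ≟ᶠ (K , i))

mulʳ-same : ∀ K i d z → mulʳ K i d (⟨ K , i , z ⟩ ∷ []) ≡ consPower K i (rotate d (just z)) []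
mulʳ-same K i d z with (K , i) ≟ᶠ (K , i)
... | yes refl = refl
... | no ≢ = ⊥-elim (≢ refl)

mulʳ-other : ∀ K i d x → factor x ≢ (K , i) → mulʳ K i d (x ∷ []) ≡ x ∷ ⟨ K , i , start d ⟩ ∷ []
mulʳ-other K i d ⟨ K′ , i′ , z ⟩ ≢ with (K′ , i′) ≟ᶠ (K , i)
... | yes eq = ⊥-elim (≢ eq)
... | no _ = refl

mulˡ-same : ∀ K i d z l → mulˡ K i d (⟨ K , i , z ⟩ ∷ l) ≡ consPower K i (rotate d (just z)) l
mulˡ-same K i d z l with (K , i) ≟ᶠ (K , i)
... | yes refl = refl
... | no ≢ = ⊥-elim (≢ refl)

mulˡ-other : ∀ K i d x l → factor x ≢ (K , i) → mulˡ K i d (x ∷ l) ≡ ⟨ K , i , start d ⟩ ∷ x ∷ l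
mulˡ-other K i d ⟨ K′ , i′ , z ⟩ l ≢ with (K′ , i′) ≟ᶠ (K , i)
... | yes eq = ⊥-elim (≢ eq)
... | no _ = refl

mulʳ-consPower : ∀ K i d c → mulʳ K i d (consPower K i c []) ≡ consPower K i (rotate d c) []
mulʳ-consPower K i d nothing = refl
mulʳ-consPower K i d (just z) = mulʳ-same K i d z

mulʳ-consPower-other : ∀ K i K′ i′ e c → (K′ , i′) ≢ (K , i) →
  mulʳ K′ i′ e (consPower K i c []) ≡ consPower K i c (⟨ K′ , i′ , start e ⟩ ∷ [])
mulʳ-consPower-other K i K′ i′ e nothing ≢ = refl
mulʳ-consPower-other K i K′ i′ e (just z) ≢ = mulʳ-other K′ i′ e ⟨ K , i , z ⟩ (≢ ∘ sym)

mulʳ-consPower-∷ : ∀ K i K′ i′ e c y l →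
  mulʳ K′ i′ e (consPower K i c (y ∷ l)) ≡ consPower K i c (mulʳ K′ i′ e (y ∷ l))
mulʳ-consPower-∷ K i K′ i′ e nothing y l = refl
mulʳ-consPower-∷ K i K′ i′ e (just z) y l = refl

mulˡ-consPower : ∀ K i d c l → T (headAvoids (K , i) l) → mulˡ K i d (consPower K i c l) ≡ consPower K i (rotate d c) l
mulˡ-consPower K i d nothing [] h = refl
mulˡ-consPower K i d nothing (y ∷ l) h = mulˡ-other K i d y l (≢ᵇ⇒≢ h)
mulˡ-consPower K i d (just z) l h = mulˡ-same K i d z l

mulˡ-consPower-other : ∀ K i K′ i′ d c → (K′ , i′) ≢ (K , i) →
  mulˡ K i d (consPower K′ i′ c []) ≡ ⟨ K , i , start d ⟩ ∷ consPower K′ i′ c []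
mulˡ-consPower-other K i K′ i′ d nothing ≢ = refl
mulˡ-consPower-other K i K′ i′ d (just z) ≢ = mulˡ-other K i d ⟨ K′ , i′ , z ⟩ [] ≢

mulʳ-mulˡ-[] : ∀ K i d K′ i′ e → Dec ((K , i) ≡ (K′ , i′)) →
  mulʳ K′ i′ e (mulˡ K i d []) ≡ mulˡ K i d (mulʳ K′ i′ e [])
mulʳ-mulˡ-[] K i d .K .i e (yes refl) = begin
    mulʳ K i e (consPower K i (rotate d nothing) [])
  ≡⟨ mulʳ-consPower K i e (rotate d nothing) ⟩
    consPower K i (rotate e (rotate d nothing)) []
  ≡⟨ cong (λ c → consPower K i c []) (rotate-comm e d nothing) ⟩
    consPower K i (rotate d (rotate e nothing)) []
  ≡⟨ mulˡ-consPower K i d (rotate e nothing) [] tt ⟨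
    mulˡ K i d (consPower K i (rotate e nothing) [])
  ∎
mulʳ-mulˡ-[] K i d K′ i′ e (no ≢) =
  trans (mulʳ-consPower-other K i K′ i′ e (just (start d)) (≢ ∘ sym))
        (sym (mulˡ-other K i d ⟨ K′ , i′ , start e ⟩ [] (≢ ∘ sym)))

mulʳ-mulˡ-[x]-same : ∀ K i d K′ i′ e z → Dec ((K , i) ≡ (K′ , i′)) →
  mulʳ K′ i′ e (mulˡ K i d (⟨ K , i , z ⟩ ∷ [])) ≡ mulˡ K i d (mulʳ K′ i′ e (⟨ K , i , z ⟩ ∷ []))
mulʳ-mulˡ-[x]-same K i d .K .i e z (yes refl) = begin
    mulʳ K i e (mulˡ K i d (⟨ K , i , z ⟩ ∷ []))
  ≡⟨ cong (mulʳ K i e) (mulˡ-same K i d z []) ⟩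
    mulʳ K i e (consPower K i (rotate d (just z)) [])
  ≡⟨ mulʳ-consPower K i e (rotate d (just z)) ⟩
    consPower K i (rotate e (rotate d (just z))) []
  ≡⟨ cong (λ c → consPower K i c []) (rotate-comm e d (just z)) ⟩
    consPower K i (rotate d (rotate e (just z))) []
  ≡⟨ mulˡ-consPower K i d (rotate e (just z)) [] tt ⟨
    mulˡ K i d (consPower K i (rotate e (just z)) [])
  ≡⟨ cong (mulˡ K i d) (mulʳ-same K i e z) ⟨
    mulˡ K i d (mulʳ K i e (⟨ K , i , z ⟩ ∷ []))
  ∎
mulʳ-mulˡ-[x]-same K i d K′ i′ e z (no ≢) = begin
    mulʳ K′ i′ e (mulˡ K i d (⟨ K , i , z ⟩ ∷ []))
  ≡⟨ cong (mulʳ K′ i′ e) (mulˡ-same K i d z []) ⟩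
    mulʳ K′ i′ e (consPower K i (rotate d (just z)) [])
  ≡⟨ mulʳ-consPower-other K i K′ i′ e (rotate d (just z)) (≢ ∘ sym) ⟩
    consPower K i (rotate d (just z)) (⟨ K′ , i′ , start e ⟩ ∷ [])
  ≡⟨ mulˡ-consPower K i d (just z) _ (≢⇒≢ᵇ (≢ ∘ sym)) ⟨
    mulˡ K i d (⟨ K , i , z ⟩ ∷ ⟨ K′ , i′ , start e ⟩ ∷ [])
  ≡⟨ cong (mulˡ K i d) (mulʳ-other K′ i′ e ⟨ K , i , z ⟩ ≢) ⟨
    mulˡ K i d (mulʳ K′ i′ e (⟨ K , i , z ⟩ ∷ []))
  ∎

mulʳ-mulˡ-[x]-other : ∀ K i d K′ i′ e x → factor x ≢ (K , i) → Dec (factor x ≡ (K′ , i′)) →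
  mulʳ K′ i′ e (mulˡ K i d (x ∷ [])) ≡ mulˡ K i d (mulʳ K′ i′ e (x ∷ []))
mulʳ-mulˡ-[x]-other K i d K′ i′ e ⟨ .K′ , .i′ , z ⟩ x≢ (yes refl) = begin
    mulʳ K′ i′ e (mulˡ K i d (⟨ K′ , i′ , z ⟩ ∷ []))
  ≡⟨ cong (mulʳ K′ i′ e) (mulˡ-other K i d ⟨ K′ , i′ , z ⟩ [] x≢) ⟩
    ⟨ K , i , start d ⟩ ∷ mulʳ K′ i′ e (⟨ K′ , i′ , z ⟩ ∷ [])
  ≡⟨ cong (⟨ K , i , start d ⟩ ∷_) (mulʳ-same K′ i′ e z) ⟩
    ⟨ K , i , start d ⟩ ∷ consPower K′ i′ (rotate e (just z)) []
  ≡⟨ mulˡ-consPower-other K i K′ i′ d (rotate e (just z)) x≢ ⟨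
    mulˡ K i d (consPower K′ i′ (rotate e (just z)) [])
  ≡⟨ cong (mulˡ K i d) (mulʳ-same K′ i′ e z) ⟨
    mulˡ K i d (mulʳ K′ i′ e (⟨ K′ , i′ , z ⟩ ∷ []))
  ∎
mulʳ-mulˡ-[x]-other K i d K′ i′ e x x≢ (no x≢′) = begin
    mulʳ K′ i′ e (mulˡ K i d (x ∷ []))
  ≡⟨ cong (mulʳ K′ i′ e) (mulˡ-other K i d x [] x≢) ⟩
    ⟨ K , i , start d ⟩ ∷ mulʳ K′ i′ e (x ∷ [])
  ≡⟨ cong (⟨ K , i , start d ⟩ ∷_) (mulʳ-other K′ i′ e x x≢′) ⟩
    ⟨ K , i , start d ⟩ ∷ x ∷ ⟨ K′ , i′ , start e ⟩ ∷ []
  ≡⟨ mulˡ-other K i d x _ x≢ ⟨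
    mulˡ K i d (x ∷ ⟨ K′ , i′ , start e ⟩ ∷ [])
  ≡⟨ cong (mulˡ K i d) (mulʳ-other K′ i′ e x x≢′) ⟨
    mulˡ K i d (mulʳ K′ i′ e (x ∷ []))
  ∎

mulʳ-mulˡ-[x] : ∀ K i d K′ i′ e x → Dec (factor x ≡ (K , i)) →
  mulʳ K′ i′ e (mulˡ K i d (x ∷ [])) ≡ mulˡ K i d (mulʳ K′ i′ e (x ∷ []))
mulʳ-mulˡ-[x] K i d K′ i′ e ⟨ .K , .i , z ⟩ (yes refl) = mulʳ-mulˡ-[x]-same K i d K′ i′ e z ((K , i) ≟ᶠ (K′ , i′))
mulʳ-mulˡ-[x] K i d K′ i′ e x (no x≢) = mulʳ-mulˡ-[x]-other K i d K′ i′ e x x≢ (factor x ≟ᶠ (K′ , i′))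

mulʳ-mulˡ-∷∷ : ∀ K i d K′ i′ e x y l → Dec (factor x ≡ (K , i)) →
  mulʳ K′ i′ e (mulˡ K i d (x ∷ y ∷ l)) ≡ mulˡ K i d (mulʳ K′ i′ e (x ∷ y ∷ l))
mulʳ-mulˡ-∷∷ K i d K′ i′ e ⟨ .K , .i , z ⟩ y l (yes refl) =
  trans (cong (mulʳ K′ i′ e) (mulˡ-same K i d z (y ∷ l)))
    (trans (mulʳ-consPower-∷ K i K′ i′ e (rotate d (just z)) y l)
           (sym (mulˡ-same K i d z (mulʳ K′ i′ e (y ∷ l)))))
mulʳ-mulˡ-∷∷ K i d K′ i′ e x y l (no x≢) =
  trans (cong (mulʳ K′ i′ e) (mulˡ-other K i d x (y ∷ l) x≢))
        (sym (mulˡ-other K i d x (mulʳ K′ i′ e (y ∷ l)) x≢))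

mulʳ-mulˡ-comm : ∀ K i d K′ i′ e l → mulʳ K′ i′ e (mulˡ K i d l) ≡ mulˡ K i d (mulʳ K′ i′ e l)
mulʳ-mulˡ-comm K i d K′ i′ e [] = mulʳ-mulˡ-[] K i d K′ i′ e ((K , i) ≟ᶠ (K′ , i′))
mulʳ-mulˡ-comm K i d K′ i′ e (x ∷ []) = mulʳ-mulˡ-[x] K i d K′ i′ e x (factor x ≟ᶠ (K , i))
mulʳ-mulˡ-comm K i d K′ i′ e (x ∷ y ∷ l) = mulʳ-mulˡ-∷∷ K i d K′ i′ e x y l (factor x ≟ᶠ (K , i))

HeadFactor : Factor → List Letter → Set
HeadFactor a [] = ⊤
HeadFactor a (y ∷ _) = factor y ≡ a

consPower-head : ∀ K i c → HeadFactor (K , i) (consPower K i c [])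
consPower-head K i nothing = tt
consPower-head K i (just z) = refl

mulʳ-last-head : ∀ K i d K′ i′ z dec → HeadFactor (K′ , i′) (mulʳ-last K i d K′ i′ z dec)
mulʳ-last-head K i d .K .i z (yes refl) = consPower-head K i (rotate d (just z))
mulʳ-last-head K i d K′ i′ z (no _) = refl

mulʳ-head : ∀ K i d y l → HeadFactor (factor y) (mulʳ K i d (y ∷ l))
mulʳ-head K i d ⟨ K′ , i′ , z ⟩ [] = mulʳ-last-head K i d K′ i′ z ((K′ , i′) ≟ᶠ (K , i))
mulʳ-head K i d ⟨ K′ , i′ , z ⟩ (y ∷ l) = refl

mulʳ-≡[] : ∀ K i d y l → mulʳ K i d (y ∷ l) ≡ [] → factor y ≡ (K , i)
mulʳ-≡[] K i d ⟨ K′ , i′ , z ⟩ [] eq with (K′ , i′) ≟ᶠ (K , i)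
... | yes same = same
mulʳ-≡[] K i d ⟨ K′ , i′ , z ⟩ (y ∷ l) ()

HeadFactor⇒headAvoids : ∀ {b a} s → HeadFactor b s → T (b ≢ᵇ a) → T (headAvoids a s)
HeadFactor⇒headAvoids [] _ _ = tt
HeadFactor⇒headAvoids (y ∷ s) refl t = t

consPower-reduced : ∀ K i c l → T (headAvoids (K , i) l) → Reduced l → Reduced (consPower K i c l)
consPower-reduced K i nothing l h r = r
consPower-reduced K i (just z) l h r = h , r

mulʳ-reduced : ∀ K i d l → Reduced l → Reduced (mulʳ K i d l)
mulʳ-reduced K i d [] r = tt , tt
mulʳ-reduced K i d (⟨ K′ , i′ , z ⟩ ∷ []) r with (K′ , i′) ≟ᶠ (K , i)
... | yes refl = consPower-reduced K i (rotate d (just z)) [] tt tt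
... | no ≢ = ≢⇒≢ᵇ (≢ ∘ sym) , tt , tt
mulʳ-reduced K i d (x ∷ y ∷ l) r =
  HeadFactor⇒headAvoids (mulʳ K i d (y ∷ l)) (mulʳ-head K i d y l) (proj₁ r) ,
  mulʳ-reduced K i d (y ∷ l) (proj₂ r)

mulˡ-reduced : ∀ K i d l → Reduced l → Reduced (mulˡ K i d l)
mulˡ-reduced K i d [] r = tt , tt
mulˡ-reduced K i d (⟨ K′ , i′ , z ⟩ ∷ l) r with (K′ , i′) ≟ᶠ (K , i)
... | yes refl = consPower-reduced K i (rotate d (just z)) l (proj₁ r) (proj₂ r)
... | no ≢ = ≢⇒≢ᵇ ≢ , r

mulʳ-∷ : ∀ K i e x s → (s ≡ [] → factor x ≢ (K , i)) → mulʳ K i e (x ∷ s) ≡ x ∷ mulʳ K i e s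
mulʳ-∷ K i e x [] h = mulʳ-other K i e x (h refl)
mulʳ-∷ K i e x (s ∷ S) h = refl

mulʳ-opposite : ∀ K i d l → Reduced l → mulʳ K i (opposite d) (mulʳ K i d l) ≡ l
mulʳ-opposite K i d [] r =
  trans (mulʳ-consPower K i (opposite d) (rotate d nothing)) (cong (λ c → consPower K i c []) (rotate-opposite d nothing))
mulʳ-opposite K i d (⟨ K′ , i′ , z ⟩ ∷ []) r with (K′ , i′) ≟ᶠ (K , i)
... | yes refl = trans (mulʳ-consPower K i (opposite d) (rotate d (just z)))
                       (cong (λ c → consPower K i c []) (rotate-opposite d (just z)))
... | no ≢ = cong (⟨ K′ , i′ , z ⟩ ∷_)
               (trans (mulʳ-same K i (opposite d) (start d)) (cong (λ c → consPower K i c []) (rotate-opposite d nothing)))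
mulʳ-opposite K i d (x ∷ y ∷ l) r =
  trans (mulʳ-∷ K i (opposite d) x (mulʳ K i d (y ∷ l))
          (λ eq x≡ → ≢ᵇ⇒≢ (proj₁ r) (trans (mulʳ-≡[] K i d y l eq) (sym x≡))))
        (cong (x ∷_) (mulʳ-opposite K i d (y ∷ l) (proj₂ r)))

⟨⟩-injective : ∀ {K i} {z z′ : Fin (suc (suc K))} → ⟨ K , i , z ⟩ ≡ ⟨ K , i , z′ ⟩ → z ≡ z′
⟨⟩-injective refl = refl

consPower-≢ : ∀ K i c z → c ≢ just z → consPower K i c [] ≢ ⟨ K , i , z ⟩ ∷ []
consPower-≢ K i nothing z _ ()
consPower-≢ K i (just z′) z ≢ eq = ≢ (cong just (⟨⟩-injective (∷-injectiveˡ eq)))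

mulʳ-≢ : ∀ K i d l → mulʳ K i d l ≢ l
mulʳ-≢ K i d [] ()
mulʳ-≢ K i d (⟨ K′ , i′ , z ⟩ ∷ []) eq with (K′ , i′) ≟ᶠ (K , i)
... | yes refl = consPower-≢ K i (rotate d (just z)) z (rotate-≢ d (just z)) eq
mulʳ-≢ K i d (x ∷ y ∷ l) eq = mulʳ-≢ K i d (y ∷ l) (∷-injectiveʳ eq)

mulˡ-opposite : ∀ K i d l → Reduced l → mulˡ K i (opposite d) (mulˡ K i d l) ≡ l
mulˡ-opposite K i d [] r =
  trans (mulˡ-consPower K i (opposite d) (rotate d nothing) [] tt) (cong (λ c → consPower K i c []) (rotate-opposite d nothing))
mulˡ-opposite K i d (⟨ K′ , i′ , z ⟩ ∷ l) r with (K′ , i′) ≟ᶠ (K , i)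
... | yes refl = trans (mulˡ-consPower K i (opposite d) (rotate d (just z)) l (proj₁ r))
                       (cong (λ c → consPower K i c l) (rotate-opposite d (just z)))
... | no ≢ = trans (mulˡ-consPower K i (opposite d) (rotate d nothing) (⟨ K′ , i′ , z ⟩ ∷ l) (≢⇒≢ᵇ ≢))
                   (cong (λ c → consPower K i c (⟨ K′ , i′ , z ⟩ ∷ l)) (rotate-opposite d nothing))

opposite-involutive : ∀ d → opposite (opposite d) ≡ d
opposite-involutive up = refl
opposite-involutive down = refl

module Relabel (g : ℕ → ℕ → ℕ) (g-involutive : ∀ K i → g K (g K i) ≡ i) where

  relabel : Letter → Letter
  relabel ⟨ K , i , z ⟩ = ⟨ K , g K i , z ⟩

  relabelᶠ : Factor → Factor
  relabelᶠ (K , i) = K , g K i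

  map-relabel-involutive : ∀ l → map relabel (map relabel l) ≡ l
  map-relabel-involutive [] = refl
  map-relabel-involutive (⟨ K , i , z ⟩ ∷ l) =
    cong₂ _∷_ (cong (λ j → ⟨ K , j , z ⟩) (g-involutive K i)) (map-relabel-involutive l)

  relabelᶠ-involutive : ∀ a → relabelᶠ (relabelᶠ a) ≡ a
  relabelᶠ-involutive (K , i) = cong (K ,_) (g-involutive K i)

  relabelᶠ-injective : ∀ {a b} → relabelᶠ a ≡ relabelᶠ b → a ≡ b
  relabelᶠ-injective {a} {b} eq =
    trans (sym (relabelᶠ-involutive a)) (trans (cong relabelᶠ eq) (relabelᶠ-involutive b))

  headAvoids-relabel : ∀ a l → T (headAvoids a l) → T (headAvoids (relabelᶠ a) (map relabel l))
  headAvoids-relabel a [] _ = tt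
  headAvoids-relabel a (⟨ K , i , z ⟩ ∷ l) h =
    ≢⇒≢ᵇ {K , g K i} {relabelᶠ a} (≢ᵇ⇒≢ {K , i} {a} h ∘ relabelᶠ-injective)

  Reduced-relabel : ∀ l → Reduced l → Reduced (map relabel l)
  Reduced-relabel [] r = tt
  Reduced-relabel (⟨ K , i , z ⟩ ∷ l) (h , r) = headAvoids-relabel (K , i) l h , Reduced-relabel l r

  map-relabel-consPower : ∀ K i c l → map relabel (consPower K i c l) ≡ consPower K (g K i) c (map relabel l)
  map-relabel-consPower K i nothing l = refl
  map-relabel-consPower K i (just z) l = refl

  mulʳ-relabel : ∀ K i d l → mulʳ K (g K i) d (map relabel l) ≡ map relabel (mulʳ K i d l)
  mulʳ-relabel K i d [] = refl
  mulʳ-relabel K i d (⟨ K′ , i′ , z ⟩ ∷ []) with (K′ , i′) ≟ᶠ (K , i) | (K′ , g K′ i′) ≟ᶠ (K , g K i)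
  ... | yes refl | yes refl = sym (map-relabel-consPower K i (rotate d (just z)) [])
  ... | yes refl | no ≢ = ⊥-elim (≢ refl)
  ... | no ≢ | yes eq = ⊥-elim (≢ (relabelᶠ-injective eq))
  ... | no _ | no _ = refl
  mulʳ-relabel K i d (x ∷ y ∷ l) = cong (relabel x ∷_) (mulʳ-relabel K i d (y ∷ l))

module _ {V : Set} {E : V → V → Set} (f : V → V) (f-E : ∀ {x y} → E x y → E (f x) (f y)) where

  iterate-preserves : ∀ j {x y} → E x y → E (iterate f j x) (iterate f j y)
  iterate-preserves zero e = e
  iterate-preserves (suc j) e = f-E (iterate-preserves j e)

  walk-iterate : ∀ {u} → E u (f u) → ∀ j → Walk E u (iterate f j u) j
  walk-iterate e zero = here
  walk-iterate e (suc j) = step e (mapWalk f f-E (walk-iterate e j))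

Word : Set
Word = Σ (List Letter) Reduced

Word-≡ : ∀ {l l′} {r : Reduced l} {r′ : Reduced l′} → l ≡ l′ → _≡_ {A = Word} (l , r) (l′ , r′)
Word-≡ {r = r} refl = cong (_ ,_) (Reduced-irrelevant r _)

ε : Word
ε = [] , tt

data CayleyEdge (u v : Word) : Set where
  edge : ∀ K i d → mulʳ K i d (proj₁ u) ≡ proj₁ v → CayleyEdge u v

CayleyEdge-sym : ∀ {u v} → CayleyEdge u v → CayleyEdge v u
CayleyEdge-sym {l , r} (edge K i d refl) = edge K i (opposite d) (mulʳ-opposite K i d l r)

CayleyEdge-irrefl : ∀ {v} → ¬ CayleyEdge v v
CayleyEdge-irrefl {l , _} (edge K i d eq) = mulʳ-≢ K i d l eq

mulˡᵂ : ℕ → ℕ → Dir → Word → Word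
mulˡᵂ K i d (l , r) = mulˡ K i d l , mulˡ-reduced K i d l r

mulˡᵂ-opposite : ∀ K i d w → mulˡᵂ K i (opposite d) (mulˡᵂ K i d w) ≡ w
mulˡᵂ-opposite K i d (l , r) = Word-≡ (mulˡ-opposite K i d l r)

mulˡᵂ-CayleyEdge : ∀ K i d {u v} → CayleyEdge u v → CayleyEdge (mulˡᵂ K i d u) (mulˡᵂ K i d v)
mulˡᵂ-CayleyEdge K i d {u} (edge K′ i′ e eq) =
  edge K′ i′ e (trans (mulʳ-mulˡ-comm K i d K′ i′ e (proj₁ u)) (cong (mulˡ K i d) eq))

rotate-up-reaches : ∀ {K} (z : Fin (suc (suc K))) → ∃[ j ] iterate (rotate up) j nothing ≡ just z
rotate-up-reaches z with iterate-up-toℕ (toℕ z) (toℕ<n z)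
... | i , eq , toℕi≡toℕz = suc (toℕ z) , trans eq (cong just (toℕ-injective toℕi≡toℕz))

iterate-mulˡᵂ : ∀ K i j l (r : Reduced l) → T (headAvoids (K , i) l) →
  proj₁ (iterate (mulˡᵂ K i up) j (l , r)) ≡ consPower K i (iterate (rotate up) j nothing) l
iterate-mulˡᵂ K i zero l r h = refl
iterate-mulˡᵂ K i (suc j) l r h =
  trans (cong (mulˡ K i up) (iterate-mulˡᵂ K i j l r h)) (mulˡ-consPower K i up (iterate (rotate up) j nothing) l h)

prepend-by-mulˡᵂ : ∀ K i z l (r : Reduced (⟨ K , i , z ⟩ ∷ l)) →
  ∃[ j ] iterate (mulˡᵂ K i up) j (l , proj₂ r) ≡ (⟨ K , i , z ⟩ ∷ l , r)
prepend-by-mulˡᵂ K i z l (h , r) with rotate-up-reaches z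
... | j , eq = j , Word-≡ (trans (iterate-mulˡᵂ K i j l r h) (cong (λ c → consPower K i c l) eq))

walk-from-ε : ∀ w → ∃[ n ] Walk CayleyEdge ε w n
walk-from-ε ([] , tt) = 0 , here
walk-from-ε (⟨ K , i , z ⟩ ∷ l , r) with prepend-by-mulˡᵂ K i z l r | walk-from-ε (l , proj₂ r)
... | j , eq | n , w =
  j + n , appendWalk (walk-iterate {E = CayleyEdge} f f-E (edge K i up refl) j)
                     (subst (λ v → Walk CayleyEdge (iterate f j ε) v n) eq translated)
  where
    f : Word → Word
    f = mulˡᵂ K i up
    f-E : ∀ {x y} → CayleyEdge x y → CayleyEdge (f x) (f y)
    f-E = mulˡᵂ-CayleyEdge K i up
    translated : Walk CayleyEdge (iterate f j ε) (iterate f j (l , proj₂ r)) n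
    translated = mapWalk (iterate f j) (λ e → iterate-preserves {E = CayleyEdge} f f-E j e) w

Cay : Graph
Cay = record
  { V = Word
  ; E = CayleyEdge
  ; E-sym = CayleyEdge-sym
  ; E-irrefl = CayleyEdge-irrefl
  ; nonempty = ε
  ; connected = λ u v → let (m , p) = walk-from-ε u ; (n , q) = walk-from-ε v in
                        m + n , appendWalk (reverseWalk CayleyEdge-sym p) q
  }

mulˡᴬ : ℕ → ℕ → Dir → Automorphism Cay
mulˡᴬ K i d = record
  { bij = mk↔ₛ′ (mulˡᵂ K i d) (mulˡᵂ K i (opposite d))
      (λ w → trans (cong (λ e → mulˡᵂ K i e (mulˡᵂ K i (opposite d) w)) (sym (opposite-involutive d)))
                   (mulˡᵂ-opposite K i (opposite d) w))
      (mulˡᵂ-opposite K i d)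
  ; adj = λ u v → mk⇔ (mulˡᵂ-CayleyEdge K i d)
      (λ e → subst₂ CayleyEdge (mulˡᵂ-opposite K i d u) (mulˡᵂ-opposite K i d v) (mulˡᵂ-CayleyEdge K i (opposite d) e))
  }

ε-to : ∀ w → Σ (Automorphism Cay) λ φ → apply φ ε ≡ w
ε-to ([] , tt) = idᴬ , refl
ε-to (⟨ K , i , z ⟩ ∷ l , r) with prepend-by-mulˡᵂ K i z l r | ε-to (l , proj₂ r)
... | j , eq | φ , refl = (mulˡᴬ K i up ^ᴬ j) ∘ᴬ φ , trans (apply-^ᴬ (mulˡᴬ K i up) j (apply φ ε)) eq

Cay-transitive : Transitive Cay
Cay-transitive = Transitive-fromBase ε ε-to

data CombEdge : ℤ × Word → ℤ × Word → Set where
  within : ∀ {p u v} → CayleyEdge u v → CombEdge (p , u) (p , v)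
  forward : ∀ {p q} → q ≡ sucℤ p → CombEdge (p , ε) (q , ε)
  backward : ∀ {p q} → p ≡ sucℤ q → CombEdge (p , ε) (q , ε)

CombEdge-sym : ∀ {x y} → CombEdge x y → CombEdge y x
CombEdge-sym (within e) = within (CayleyEdge-sym e)
CombEdge-sym (forward eq) = backward eq
CombEdge-sym (backward eq) = forward eq

CombEdge-irrefl : ∀ {x} → ¬ CombEdge x x
CombEdge-irrefl (within e) = CayleyEdge-irrefl e
CombEdge-irrefl (forward eq) = ℤ.i≢suc[i] eq
CombEdge-irrefl (backward eq) = ℤ.i≢suc[i] eq

walk-along-line : ∀ p → ∃[ n ] Walk CombEdge (p , ε) (+ 0 , ε) n
walk-along-line (+ zero) = 0 , here
walk-along-line (+ suc n) = let (k , w) = walk-along-line (+ n) in suc k , step (backward refl) w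
walk-along-line -[1+ zero ] = 1 , step (forward refl) here
walk-along-line -[1+ suc n ] = let (k , w) = walk-along-line -[1+ n ] in suc k , step (forward refl) w

walk-to-origin : ∀ x → ∃[ n ] Walk CombEdge x (+ 0 , ε) n
walk-to-origin (p , u) =
  let (m , w) = connected Cay u ε ; (n , w′) = walk-along-line p in
  m + n , appendWalk (mapWalk (p ,_) within w) w′

Comb : Graph
Comb = record
  { V = ℤ × Word
  ; E = CombEdge
  ; E-sym = CombEdge-sym
  ; E-irrefl = CombEdge-irrefl
  ; nonempty = + 0 , ε
  ; connected = λ x y → let (m , w) = walk-to-origin x ; (n , w′) = walk-to-origin y in
                        m + n , appendWalk w (reverseWalk CombEdge-sym w′)
  }

+-sucℤ : ∀ k p → k +ℤ sucℤ p ≡ sucℤ (k +ℤ p)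
+-sucℤ k p = x∙yz≈y∙xz k 1ℤ p

-‿+-cancel : ∀ k p → -ℤ k +ℤ (k +ℤ p) ≡ p
-‿+-cancel k p = trans (sym (ℤ.+-assoc (-ℤ k) k p)) (trans (cong (_+ℤ p) (ℤ.+-inverseˡ k)) (ℤ.+-identityˡ p))

translate : ℤ → ℤ × Word → ℤ × Word
translate k (p , u) = k +ℤ p , u

translate-CombEdge : ∀ k {x y} → CombEdge x y → CombEdge (translate k x) (translate k y)
translate-CombEdge k (within e) = within e
translate-CombEdge k {p , _} (forward refl) = forward (+-sucℤ k p)
translate-CombEdge k {_} {q , _} (backward refl) = backward (+-sucℤ k q)

translate-cancel : ∀ k x → translate (-ℤ k) (translate k x) ≡ x
translate-cancel k (p , u) = cong (_, u) (-‿+-cancel k p)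

translateᴬ : ℤ → Automorphism Comb
translateᴬ k = record
  { bij = mk↔ₛ′ (translate k) (translate (-ℤ k))
      (λ x → trans (cong (λ j → translate j (translate (-ℤ k) x)) (sym (ℤ.neg-involutive k)))
                   (translate-cancel (-ℤ k) x))
      (translate-cancel k)
  ; adj = λ x y → mk⇔ (translate-CombEdge k)
      (λ e → subst₂ CombEdge (translate-cancel k x) (translate-cancel k y) (translate-CombEdge (-ℤ k) e))
  }

translate-to-origin : ∀ p u → Σ (Automorphism Comb) λ φ → apply φ (p , u) ≡ (+ 0 , u)
translate-to-origin p u = translateᴬ (-ℤ p) , cong (_, u) (ℤ.+-inverseˡ p)

Positive : ℤ × Word → Set
Positive (+ suc _ , _) = ⊤
Positive _ = ⊥

Positive-step : ∀ {x y} → Avoiding {Comb} (+ 0 , ε) x y → Positive x → Positive y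
Positive-step {+ suc _ , _} (within _ , _) _ = tt
Positive-step {+ suc _ , _} (forward refl , _) _ = tt
Positive-step {_} {+ zero , _} (backward refl , _ , y≢origin) _ = y≢origin refl
Positive-step {_} {+ suc _ , _} (backward refl , _) _ = tt
Positive-step {_} { -[1+ zero ] , _} (backward refl , _) ()
Positive-step {_} { -[1+ suc _ ] , _} (backward refl , _) ()

Positive-walk : ∀ {x y n} → Walk (Avoiding {Comb} (+ 0 , ε)) x y n → Positive x → Positive y
Positive-walk here pos = pos
Positive-walk (step e w) pos = Positive-walk w (Positive-step e pos)

origin-bridge : IncidentToBridge {Comb} (+ 0 , ε)
origin-bridge = (+ 1 , ε) , forward refl , λ b e b≢ n w → other-neighbour-¬Positive e b≢ (Positive-walk w tt)
  where
    other-neighbour-¬Positive : ∀ {b} → CombEdge (+ 0 , ε) b → b ≢ (+ 1 , ε) → ¬ Positive b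
    other-neighbour-¬Positive (within _) _ ()
    other-neighbour-¬Positive (forward refl) b≢ _ = b≢ refl
    other-neighbour-¬Positive {+ _ , _} (backward ()) _
    other-neighbour-¬Positive { -[1+ _ ] , _} (backward _) _ ()

module CycleOfFactor (K i : ℕ) where

  power : Fin (suc (suc K)) → Word
  power z = ⟨ K , i , z ⟩ ∷ [] , tt , tt

  walk-next : ∀ {n} → Walk (λ (a b : Fin (suc n)) → next a ≡ just b) zero (fromℕ n) n
  walk-next {zero} = here
  walk-next {suc n} = step refl (mapWalk suc (cong (Maybe.map suc)) walk-next)

  power-Avoiding : ∀ {z z′} → next z ≡ just z′ → Avoiding {Cay} ε (power z) (power z′)
  power-Avoiding {z} eq = edge K i up (trans (mulʳ-same K i up z) (cong (λ c → consPower K i c []) eq)) , (λ ()) , (λ ())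

  walk-around : Walk (Avoiding {Cay} ε) (power zero) (power (fromℕ (suc K))) (suc K)
  walk-around = mapWalk power power-Avoiding walk-next

Cay-no-bridge-at-ε : ¬ IncidentToBridge {Cay} ε
Cay-no-bridge-at-ε ((_ , _) , edge K i d refl , isolated) with d
... | up = isolated (power (fromℕ (suc K))) (edge K i down refl) (λ ()) (suc K) walk-around
  where open CycleOfFactor K i
... | down = isolated (power zero) (edge K i up refl) (λ ()) (suc K) (reverseWalk sym-Avoiding walk-around)
  where
    open CycleOfFactor K i
    sym-Avoiding : ∀ {x y} → Avoiding {Cay} ε x y → Avoiding {Cay} ε y x
    sym-Avoiding (e , x≢ , y≢) = CayleyEdge-sym e , y≢ , x≢

Cay-no-bridge : ∀ u → ¬ IncidentToBridge {Cay} u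
Cay-no-bridge u bridge with Cay-transitive u ε
... | φ , φu≡ε = Cay-no-bridge-at-ε (subst (IncidentToBridge {Cay}) φu≡ε (IncidentToBridge-apply φ bridge))

Comb-bridge⇒Cay-bridge : ∀ {p w} → proj₁ w ≢ [] → IncidentToBridge {Comb} (p , w) → IncidentToBridge {Cay} w
Comb-bridge⇒Cay-bridge w≢ε (_ , forward _ , _) = ⊥-elim (w≢ε refl)
Comb-bridge⇒Cay-bridge w≢ε (_ , backward _ , _) = ⊥-elim (w≢ε refl)
Comb-bridge⇒Cay-bridge {p} {w} w≢ε ((.p , a) , within wa , isolated) =
  a , wa , λ b wb b≢a n walk → isolated (p , b) (within wb) (b≢a ∘ cong proj₂) n (mapWalk (p ,_) lift walk)
  where
    lift : ∀ {x y} → Avoiding {Cay} w x y → Avoiding {Comb} (p , w) (p , x) (p , y)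
    lift (e , x≢ , y≢) = within e , x≢ ∘ cong proj₂ , y≢ ∘ cong proj₂

Comb-not-transitive : ¬ Transitive Comb
Comb-not-transitive = ¬Transitive-byBridge origin-bridge
  (Cay-no-bridge (⟨ 0 , 0 , zero ⟩ ∷ [] , tt , tt) ∘ Comb-bridge⇒Cay-bridge {+ 0} (λ ()))

transpose : ℕ → ℕ → ℕ
transpose a i with i ≟ a
... | yes _ = suc a
... | no _ with i ≟ suc a
...   | yes _ = a
...   | no _ = i

transpose-a : ∀ a → transpose a a ≡ suc a
transpose-a a with a ≟ a
... | yes _ = refl
... | no a≢a = ⊥-elim (a≢a refl)

transpose-suc : ∀ a → transpose a (suc a) ≡ a
transpose-suc a with suc a ≟ a
... | yes eq = ⊥-elim (1+n≢n eq)
... | no _ with suc a ≟ suc a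
...   | yes _ = refl
...   | no ≢ = ⊥-elim (≢ refl)

transpose-other : ∀ {a i} → i ≢ a → i ≢ suc a → transpose a i ≡ i
transpose-other {a} {i} i≢a i≢sa with i ≟ a
... | yes eq = ⊥-elim (i≢a eq)
... | no _ with i ≟ suc a
...   | yes eq = ⊥-elim (i≢sa eq)
...   | no _ = refl

transpose-involutive′ : ∀ a i → Dec (i ≡ a) → Dec (i ≡ suc a) → transpose a (transpose a i) ≡ i
transpose-involutive′ a .a (yes refl) _ = trans (cong (transpose a) (transpose-a a)) (transpose-suc a)
transpose-involutive′ a .(suc a) (no _) (yes refl) = trans (cong (transpose a) (transpose-suc a)) (transpose-a a)
transpose-involutive′ a i (no i≢a) (no i≢sa) =
  trans (cong (transpose a) (transpose-other i≢a i≢sa)) (transpose-other i≢a i≢sa)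

transpose-involutive : ∀ a i → transpose a (transpose a i) ≡ i
transpose-involutive a i = transpose-involutive′ a i (i ≟ a) (i ≟ suc a)

module LocalIso (R : ℕ) where

  -- The cycle of the factor (M , 0) has M + 3 = 2 (R + 1) + 1 vertices, as many as the segment
  -- of the line within distance R + 1 of the origin, which it receives injectively.
  M : ℕ
  M = R + R

  relabelIndex : Factor → ℕ → ℕ → ℕ
  relabelIndex (Ka , a) K i with Ka ≟ M | K ≟ M
  ... | yes _ | yes _ = transpose a i
  ... | _ | _ = i

  relabelIndex-involutive : ∀ a K i → relabelIndex a K (relabelIndex a K i) ≡ i
  relabelIndex-involutive (Ka , a) K i with Ka ≟ M | K ≟ M
  ... | yes _ | yes _ = transpose-involutive a i
  ... | yes _ | no _ = refl
  ... | no _ | yes _ = refl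
  ... | no _ | no _ = refl

  headIndex : ℕ → ℕ → ℕ
  headIndex K i = relabelIndex (K , i) K i

  headIndex-injective : ∀ K {i i′} → headIndex K i ≡ headIndex K i′ → i ≡ i′
  headIndex-injective K {i} {i′} eq with K ≟ M
  ... | yes _ = suc-injective (trans (sym (transpose-a i)) (trans eq (transpose-a i′)))
  ... | no _ = eq

  headIndex-≢ : ∀ K i → (K , headIndex K i) ≢ (M , 0)
  headIndex-≢ K i eq with K ≟ M
  ... | yes _ = 1+n≢0 (trans (sym (transpose-a i)) (cong proj₂ eq))
  ... | no K≢M = K≢M (cong proj₁ eq)

  headIndex-surjective : ∀ K b → (K , b) ≢ (M , 0) → ∃[ b° ] headIndex K b° ≡ b
  headIndex-surjective K b ≢ with K ≟ M
  headIndex-surjective K zero ≢ | yes refl = ⊥-elim (≢ refl)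
  headIndex-surjective K (suc b) ≢ | yes refl = b , transpose-a b
  ... | no _ = b , refl

  module Rel (a : Factor) = Relabel (relabelIndex a) (relabelIndex-involutive a)

  -- If the first letter lies in the factor (M , a), the word is relabelled by the involution
  -- exchanging the factors (M , a) and (M , a + 1): the first letter then avoids (M , 0),
  -- and relabelling commutes with mulʳ.
  clearHead : List Letter → List Letter
  clearHead [] = []
  clearHead (x ∷ l) = map (Rel.relabel (factor x)) (x ∷ l)

  clearHead-HeadFactor : ∀ a s → HeadFactor a s → clearHead s ≡ map (Rel.relabel a) s
  clearHead-HeadFactor a [] _ = refl
  clearHead-HeadFactor a (y ∷ s) refl = refl

  clearHead-avoids : ∀ l → T (headAvoids (M , 0) (clearHead l))
  clearHead-avoids [] = tt
  clearHead-avoids (⟨ K , i , z ⟩ ∷ l) = ≢⇒≢ᵇ (headIndex-≢ K i)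

  clearHead-reduced : ∀ l → Reduced l → Reduced (clearHead l)
  clearHead-reduced [] r = tt
  clearHead-reduced (x ∷ l) r = Rel.Reduced-relabel (factor x) (x ∷ l) r

  clearHead-injective : ∀ l l′ → clearHead l ≡ clearHead l′ → l ≡ l′
  clearHead-injective [] [] eq = refl
  clearHead-injective (⟨ K , i , z ⟩ ∷ l) (⟨ K′ , i′ , z′ ⟩ ∷ l′) eq with ∷-injectiveˡ eq
  ... | eq₁ with cong Letter.K eq₁
  ... | refl with headIndex-injective K (cong Letter.i eq₁)
  ... | refl with ⟨⟩-injective eq₁
  ... | refl = cong (⟨ K , i , z ⟩ ∷_)
     (trans (sym (Rel.map-relabel-involutive (K , i) l))
     (trans (cong (map (Rel.relabel (K , i))) (∷-injectiveʳ eq)) (Rel.map-relabel-involutive (K , i) l′)))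

  linePos : ℤ → Cyc (suc M)
  linePos (+ n) = iterate (rotate up) n nothing
  linePos -[1+ n ] = iterate (rotate down) (suc n) nothing

  linePos-suc : ∀ p → linePos (sucℤ p) ≡ rotate up (linePos p)
  linePos-suc (+ n) = refl
  linePos-suc -[1+ zero ] = sym (rotate-opposite down nothing)
  linePos-suc -[1+ suc n ] = sym (rotate-opposite down (linePos -[1+ n ]))

  linePos-pred : ∀ p → linePos (predℤ p) ≡ rotate down (linePos p)
  linePos-pred (+ zero) = refl
  linePos-pred (+ suc n) = sym (rotate-opposite up (linePos (+ n)))
  linePos-pred -[1+ n ] = refl

  ≤R⇒<2+M : ∀ {k} → k ≤ R → k < suc (suc M)
  ≤R⇒<2+M k≤R = s≤s (≤-trans k≤R (≤-trans (m≤m+n R R) (n≤1+n M)))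

  index : Cyc (suc M) → ℕ
  index nothing = zero
  index (just i) = suc (toℕ i)

  index-linePos-+ : ∀ k → k ≤ suc R → index (linePos (+ k)) ≡ k
  index-linePos-+ zero _ = refl
  index-linePos-+ (suc k) (s≤s k≤R) with iterate-up-toℕ {suc M} k (≤R⇒<2+M k≤R)
  ... | i , eq , toℕi≡k = trans (cong index eq) (cong suc toℕi≡k)

  index-linePos-- : ∀ k → k < suc R → index (linePos -[1+ k ]) + k ≡ suc (suc M)
  index-linePos-- k (s≤s k≤R) with iterate-down-toℕ {suc M} k (≤R⇒<2+M k≤R)
  ... | i , eq , i+k≡ = trans (cong (λ c → index c + k) eq) (cong suc i+k≡)

  index-linePos-+≢-[1+] : ∀ k k′ → k ≤ suc R → k′ < suc R → index (linePos (+ k)) ≢ index (linePos -[1+ k′ ])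
  index-linePos-+≢-[1+] k k′ k≤ k′< eq = <-irrefl sum≡ (s≤s (+-mono-≤ k≤ (≤-pred k′<)))
    where
      sum≡ : k + k′ ≡ suc (suc M)
      sum≡ = trans (cong (_+ k′) (trans (sym (index-linePos-+ k k≤)) eq)) (index-linePos-- k′ k′<)

  linePos-injective : ∀ p p′ → ∣ p ∣ ≤ suc R → ∣ p′ ∣ ≤ suc R → linePos p ≡ linePos p′ → p ≡ p′
  linePos-injective (+ k) (+ k′) b b′ eq =
    cong +_ (trans (sym (index-linePos-+ k b)) (trans (cong index eq) (index-linePos-+ k′ b′)))
  linePos-injective -[1+ k ] -[1+ k′ ] b b′ eq =
    cong -[1+_] (+-cancelˡ-≡ _ k k′ (trans (index-linePos-- k b) (trans (sym (index-linePos-- k′ b′))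
      (cong (λ c → index c + k′) (sym eq)))))
  linePos-injective (+ k) -[1+ k′ ] b b′ eq = ⊥-elim (index-linePos-+≢-[1+] k k′ b b′ (cong index eq))
  linePos-injective -[1+ k ] (+ k′) b b′ eq = ⊥-elim (index-linePos-+≢-[1+] k′ k b′ b (cong index (sym eq)))

  -- (p , w) ↦ gᵖ · w′, where g generates the factor (M , 0) and w′ is w relabelled by clearHead.
  embed : ℤ × Word → Word
  embed (p , (l , r)) = consPower M 0 (linePos p) (clearHead l) ,
                        consPower-reduced M 0 (linePos p) (clearHead l) (clearHead-avoids l) (clearHead-reduced l r)

  embed-E : ∀ {x y} → CombEdge x y → CayleyEdge (embed x) (embed y)
  embed-E {p , ([] , _)} (within (edge B b e refl)) =
    edge B (headIndex B b) e (mulʳ-consPower-other M 0 B (headIndex B b) e (linePos p) (headIndex-≢ B b))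
  embed-E {p , (x ∷ l , _)} {_ , (l′ , _)} (within (edge B b e eq)) =
    edge B (relabelIndex (factor x) B b) e (begin
        mulʳ B b′ e (consPower M 0 (linePos p) (clearHead (x ∷ l)))
      ≡⟨ mulʳ-consPower-∷ M 0 B b′ e (linePos p) _ _ ⟩
        consPower M 0 (linePos p) (mulʳ B b′ e (map ρ (x ∷ l)))
      ≡⟨ cong (consPower M 0 (linePos p)) (Rel.mulʳ-relabel (factor x) B b e (x ∷ l)) ⟩
        consPower M 0 (linePos p) (map ρ (mulʳ B b e (x ∷ l)))
      ≡⟨ cong (consPower M 0 (linePos p) ∘ map ρ) eq ⟩
        consPower M 0 (linePos p) (map ρ l′)
      ≡⟨ cong (consPower M 0 (linePos p)) (clearHead-HeadFactor (factor x) l′ head-l′) ⟨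
        consPower M 0 (linePos p) (clearHead l′)
      ∎)
    where
      ρ = Rel.relabel (factor x)
      b′ = relabelIndex (factor x) B b
      head-l′ : HeadFactor (factor x) l′
      head-l′ = subst (HeadFactor (factor x)) eq (mulʳ-head B b e x l)
  embed-E {p , _} (forward refl) =
    edge M 0 up (trans (mulʳ-consPower M 0 up (linePos p)) (cong (λ c → consPower M 0 c []) (sym (linePos-suc p))))
  embed-E {_} {q , _} (backward refl) =
    edge M 0 down (trans (mulʳ-consPower M 0 down (linePos (sucℤ q)))
      (cong (λ c → consPower M 0 c []) (trans (cong (rotate down) (linePos-suc q)) (rotate-opposite up (linePos q)))))

  embed-lifts-at-line : ∀ p B b d {m} → mulʳ B b d (consPower M 0 (linePos p) []) ≡ m → Dec ((B , b) ≡ (M , 0)) →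
    Σ (ℤ × Word) λ y → CombEdge (p , ε) y × proj₁ (embed y) ≡ m
  embed-lifts-at-line p .M .0 up eq (yes refl) =
    (sucℤ p , ε) , forward refl ,
    trans (cong (λ c → consPower M 0 c []) (linePos-suc p)) (trans (sym (mulʳ-consPower M 0 up (linePos p))) eq)
  embed-lifts-at-line p .M .0 down eq (yes refl) =
    (predℤ p , ε) , backward (sym (ℤ.suc-pred p)) ,
    trans (cong (λ c → consPower M 0 c []) (linePos-pred p)) (trans (sym (mulʳ-consPower M 0 down (linePos p))) eq)
  embed-lifts-at-line p B b d eq (no ≢) with headIndex-surjective B b ≢
  ... | b° , refl =
    (p , (⟨ B , b° , start d ⟩ ∷ [] , tt , tt)) , within (edge B b° d refl) ,
    trans (sym (mulʳ-consPower-other M 0 B (headIndex B b°) d (linePos p) ≢)) eq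

  embed-lifts : ∀ x w → CayleyEdge (embed x) w → Σ (ℤ × Word) λ y → CombEdge x y × embed y ≡ w
  embed-lifts (p , ([] , tt)) (m , _) (edge B b d eq) with embed-lifts-at-line p B b d eq ((B , b) ≟ᶠ (M , 0))
  ... | y , e , eq′ = y , e , Word-≡ eq′
  embed-lifts (p , (x ∷ l , r)) (m , _) (edge B b d eq) =
    (p , (mulʳ B b′ d (x ∷ l) , mulʳ-reduced B b′ d (x ∷ l) r)) , within (edge B b′ d refl) , Word-≡ (begin
        consPower M 0 (linePos p) (clearHead (mulʳ B b′ d (x ∷ l)))
      ≡⟨ cong (consPower M 0 (linePos p)) (clearHead-HeadFactor (factor x) _ (mulʳ-head B b′ d x l)) ⟩
        consPower M 0 (linePos p) (map ρ (mulʳ B b′ d (x ∷ l)))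
      ≡⟨ cong (consPower M 0 (linePos p)) (Rel.mulʳ-relabel (factor x) B b′ d (x ∷ l)) ⟨
        consPower M 0 (linePos p) (mulʳ B (relabelIndex (factor x) B b′) d (map ρ (x ∷ l)))
      ≡⟨ cong (λ j → consPower M 0 (linePos p) (mulʳ B j d (map ρ (x ∷ l)))) (relabelIndex-involutive (factor x) B b) ⟩
        consPower M 0 (linePos p) (mulʳ B b d (map ρ (x ∷ l)))
      ≡⟨ mulʳ-consPower-∷ M 0 B b d (linePos p) _ _ ⟨
        mulʳ B b d (consPower M 0 (linePos p) (clearHead (x ∷ l)))
      ≡⟨ eq ⟩
        m
      ∎)
    where
      ρ = Rel.relabel (factor x)
      b′ = relabelIndex (factor x) B b

  consPower-injective : ∀ c c′ s s′ → T (headAvoids (M , 0) s) → T (headAvoids (M , 0) s′) →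
    consPower M 0 c s ≡ consPower M 0 c′ s′ → c ≡ c′ × s ≡ s′
  consPower-injective nothing nothing s s′ h h′ eq = refl , eq
  consPower-injective nothing (just z′) s s′ h h′ refl = ⊥-elim (≢ᵇ⇒≢ {M , 0} {M , 0} h refl)
  consPower-injective (just z) nothing s s′ h h′ refl = ⊥-elim (≢ᵇ⇒≢ {M , 0} {M , 0} h′ refl)
  consPower-injective (just z) (just z′) s s′ h h′ eq = cong just (⟨⟩-injective (∷-injectiveˡ eq)) , ∷-injectiveʳ eq

  height : ℤ × Word → ℕ
  height (p , _) = ∣ p ∣

  embed-injective : ∀ x y → height x ≤ suc R → height y ≤ suc R → embed x ≡ embed y → x ≡ y
  embed-injective (p , (l , r)) (p′ , (l′ , r′)) b b′ eq
    with consPower-injective (linePos p) (linePos p′) (clearHead l) (clearHead l′)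
           (clearHead-avoids l) (clearHead-avoids l′) (cong proj₁ eq)
  ... | eq₁ , eq₂ = cong₂ _,_ (linePos-injective p p′ b b′ eq₁) (Word-≡ (clearHead-injective l l′ eq₂))

  height-step : ∀ {x y} → CombEdge x y → height y ≤ suc (height x)
  height-step {p , _} (within _) = n≤1+n ∣ p ∣
  height-step {p , _} (forward refl) = ℤ.∣i+j∣≤∣i∣+∣j∣ 1ℤ p
  height-step {_} {q , _} (backward refl) =
    subst (λ t → ∣ t ∣ ≤ suc ∣ sucℤ q ∣) (ℤ.pred-suc q) (ℤ.∣i+j∣≤∣i∣+∣j∣ -1ℤ (sucℤ q))

  height-walk : ∀ {x y n} → Walk CombEdge x y n → height y ≤ height x + n
  height-walk {x} here = m≤m+n (height x) 0
  height-walk {x} {n = suc n} (step e w) =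
    ≤-trans (height-walk w) (≤-trans (+-mono-≤ (height-step e) (≤-refl {n})) (≤-reflexive (sym (+-suc (height x) n))))

  lift-walk : ∀ {x w n} → Walk CayleyEdge (embed x) w n → Σ (ℤ × Word) λ y → embed y ≡ w × Walk CombEdge x y n
  lift-walk {x} here = x , refl , here
  lift-walk {x} (step e γ) with embed-lifts x _ e
  ... | x₁ , e₁ , refl with lift-walk γ
  ...   | y , eq , γ′ = y , eq , step e₁ γ′

  module _ (u : Word) where

    o : ℤ × Word
    o = + 0 , u

    ballHeight : (x : Ball Comb o R) → height (proj₁ x) ≤ R
    ballHeight (x , n , n≤R , w) = ≤-trans (height-walk w) n≤R

    liftBall : (y : Ball Cay (embed o) R) → Σ (Ball Comb o R) λ x → embed (proj₁ x) ≡ proj₁ y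
    liftBall (y , n , n≤R , w) with lift-walk w
    ... | x , eq , w′ = (x , n , n≤R , w′) , eq

    ball-embed-injective : (x y : Ball Comb o R) → embed (proj₁ x) ≡ embed (proj₁ y) → proj₁ x ≡ proj₁ y
    ball-embed-injective x y = embed-injective _ _ (≤-trans (ballHeight x) (n≤1+n R)) (≤-trans (ballHeight y) (n≤1+n R))

    -- The lifted edge ends at height ≤ R + 1, where embed is still injective.
    embed-reflects-E : (x y : Ball Comb o R) →
      CayleyEdge (embed (proj₁ x)) (embed (proj₁ y)) → CombEdge (proj₁ x) (proj₁ y)
    embed-reflects-E x y e with embed-lifts (proj₁ x) _ e
    ... | y′ , e′ , eq =
      subst (CombEdge (proj₁ x))
        (embed-injective y′ (proj₁ y) (≤-trans (height-step e′) (s≤s (ballHeight x)))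
                                      (≤-trans (ballHeight y) (n≤1+n R)) eq)
        e′

    embedBallMap : Ball Comb o R → Ball Cay (embed o) R
    embedBallMap (x , n , n≤R , w) = embed x , n , n≤R , mapWalk embed embed-E w

    embedBall : BallIso Comb o Cay (embed o) R
    embedBall = record
      { to = embedBallMap
      ; from = λ y → proj₁ (liftBall y)
      ; to-cong = λ { x y refl → refl }
      ; from-cong = λ x y eq → ball-embed-injective (proj₁ (liftBall x)) (proj₁ (liftBall y))
                                 (trans (proj₂ (liftBall x)) (trans eq (sym (proj₂ (liftBall y)))))
      ; from-to = λ x → ball-embed-injective (proj₁ (liftBall (embedBallMap x))) x (proj₂ (liftBall (embedBallMap x)))
      ; to-from = λ y → proj₂ (liftBall y)
      ; to-adj = λ x y → mk⇔ embed-E (embed-reflects-E x y)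
      ; to-root = refl
      }

WeaklyIsomorphic⇒WeaklyTransitive : ∀ {G H} → WeaklyIsomorphic G H → WeaklyTransitive G
WeaklyIsomorphic⇒WeaklyTransitive {H = H} iso o o′ n =
  BallIso-trans (iso o (nonempty H) n) (BallIso-sym (iso o′ (nonempty H) n))

Comb-weaklyIsomorphic : WeaklyIsomorphic Comb Cay
Comb-weaklyIsomorphic (p , u) o′ k =
  let (φ , φx≡o) = translate-to-origin p u
      (χ , χy≡o′) = Cay-transitive (embed (+ 0 , u)) o′
  in BallIso-trans (Automorphism⇒BallIso φ (suc k) φx≡o)
       (BallIso-trans (embedBall u) (Automorphism⇒BallIso χ (suc k) χy≡o′))
  where open LocalIso (suc k)

mainTheorem6 : Σ Graph λ G → Σ Graph λ H →
  WeaklyTransitive G × Transitive H × WeaklyIsomorphic G H × ¬ Transitive G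
mainTheorem6 =
  Comb , Cay , WeaklyIsomorphic⇒WeaklyTransitive Comb-weaklyIsomorphic , Cay-transitive ,
  Comb-weaklyIsomorphic , Comb-not-transitive
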